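{- Let $P$ be a $k\times k$ permutation matrix whose Füredi–Hajnal limit is $c_P=k^a$ for a positive constant $a$. Then for all positive integers $s,t$ with $s\le t$ and $s> k^a$, $$f_P(t,s)\le \frac{k^a t}{s-k^a}.$$
   Context: A binary matrix has all entries in $\{0,1\}$; a permutation matrix has exactly one 1-entry in each row and column. A binary matrix $A$ contains a $k\times l$ binary matrix $P$ if $A$ has a $k\times l$ submatrix $B$ (chosen rows and columns, kept in order) with $B(i,j)=1$ whenever $P(i,j)=1$; otherwise $A$ avoids $P$. $\mathrm{ex}_P(n)$ is the maximum number of 1-entries in an $n\times n$ binary matrix avoiding $P$, and the Füredi–Hajnal limit (extremal constant) is $c_P=\lim_{n\to\infty}\mathrm{ex}_P(n)/n$. For integers $s\le t$, $f_P(t,s)$ is the maximum $N$ such that there exists an $N\times t$ binary matrix with at least $s$ ones in each row that avoids $P$. -}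

module Defs where

open import Data.Bool using (Bool; true; false)
open import Data.Nat as ℕ using (ℕ; zero; suc; _≤_)
open import Data.Fin as Fin using (Fin)
open import Data.Product using (Σ; ∃; _×_; _,_)
open import Data.Integer using (+_)
open import Data.Rational as ℚ using (ℚ; 0ℚ; 1ℚ)
open import Relation.Binary.PropositionalEquality using (_≡_)
open import Relation.Nullary using (¬_)

Matrix : ℕ → ℕ → Set
Matrix m n = Fin m → Fin n → Bool

rowOnes : ∀ {n} → (Fin n → Bool) → ℕ
rowOnes {zero}  r = 0
rowOnes {suc n} r with r Fin.zero
... | true  = suc (rowOnes (λ j → r (Fin.suc j)))
... | false = rowOnes (λ j → r (Fin.suc j))

ones : ∀ {m n} → Matrix m n → ℕ
ones {zero}  A = 0
ones {suc m} A = rowOnes (A Fin.zero) ℕ.+ ones (λ i → A (Fin.suc i))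

IsPermutationMatrix : ∀ {k} → Matrix k k → Set
IsPermutationMatrix {k} P =
  (∀ i → Σ (Fin k) λ j → P i j ≡ true × (∀ j′ → P i j′ ≡ true → j′ ≡ j)) ×
  (∀ j → Σ (Fin k) λ i → P i j ≡ true × (∀ i′ → P i′ j ≡ true → i′ ≡ i))

StrictlyIncreasing : ∀ {a b} → (Fin a → Fin b) → Set
StrictlyIncreasing {a} f = ∀ (i j : Fin a) → i Fin.< j → f i Fin.< f j

Contains : ∀ {m n k l} → Matrix m n → Matrix k l → Set
Contains {m} {n} {k} {l} A P =
  Σ (Fin k → Fin m) λ r → Σ (Fin l → Fin n) λ c →
    StrictlyIncreasing r × StrictlyIncreasing c ×
    (∀ i j → P i j ≡ true → A (r i) (c j) ≡ true)

Avoids : ∀ {m n k l} → Matrix m n → Matrix k l → Set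
Avoids A P = ¬ Contains A P

IsEx : ∀ {k l} → Matrix k l → ℕ → ℕ → Set
IsEx P n e =
  (Σ (Matrix n n) λ A → Avoids A P × ones A ≡ e) ×
  (∀ (A : Matrix n n) → Avoids A P → ones A ≤ e)

-- The sequence r m = ex(m+1)/(m+1) whose limit is the Füredi–Hajnal limit c_P.
ratioSeq : (ℕ → ℕ) → ℕ → ℚ
ratioSeq ex m = (+ ex (suc m)) ℚ./ (suc m)

ℕtoℚ : ℕ → ℚ
ℕtoℚ n = (+ n) ℚ./ 1

LimitExists : (ℕ → ℚ) → Set
LimitExists r = ∀ ε → 0ℚ ℚ.< ε → ∃ λ n₀ → ∀ m n → n₀ ≤ m → n₀ ≤ n →
  ℚ.∣ r m ℚ.- r n ∣ ℚ.< ε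

LimGreater : (ℕ → ℚ) → ℚ → Set
LimGreater r q = ∃ λ δ → 0ℚ ℚ.< δ × ∃ λ n₀ → ∀ n → n₀ ≤ n → q ℚ.+ δ ℚ.≤ r n

LimLess : (ℕ → ℚ) → ℚ → Set
LimLess r q = ∃ λ δ → 0ℚ ℚ.< δ × ∃ λ n₀ → ∀ n → n₀ ≤ n → r n ℚ.+ δ ℚ.≤ q

-- N * (s - c) ≤ c * t  where c = lim r, i.e. lim (c_n t - N (s - c_n)) ≥ 0
BoundHolds : (ℕ → ℚ) → ℕ → ℕ → ℕ → Set
BoundHolds r N s t = ∀ ε → 0ℚ ℚ.< ε → ∃ λ n₀ → ∀ n → n₀ ≤ n →
  ℕtoℚ N ℚ.* (ℕtoℚ s ℚ.- r n) ℚ.≤ r n ℚ.* ℕtoℚ t ℚ.+ ε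

module Submission where

-- If P is a permutation matrix and X, Y avoid P, then so does one of the block matrices
-- [X 0; 0 Y] and [0 X; Y 0]: an occurrence of P meeting both row blocks has its first row in
-- the first block and its last row in the second, so the 1s of those two rows of P lie in
-- opposite column blocks, in an order fixed by the placement; choosing the placement that
-- contradicts the order of these two columns in P rules this out. Hence ex_P is
-- superadditive, which gives ex_P(m) n ≤ ex_P(m) m + ex_P(n) m. Padding an N × t matrix
-- with at least s ones per row by zeros shows N s ≤ ex_P(N + t), so with m = N + t,
-- N s (n + 1) ≤ ex_P(m) m + ex_P(n + 1) m; dividing by n + 1 gives N s ≤ c_P (N + t) in
-- the limit, i.e. N (s - c_P) ≤ c_P t.

open import Defs
open import Algebra.Properties.CommutativeSemigroup using (interchange)
open import Data.Bool using (Bool; true; false)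
open import Data.Empty using (⊥)
open import Data.Fin as Fin using (Fin; toℕ; _↑ˡ_; _↑ʳ_; splitAt; fromℕ)
import Data.Fin.Properties as Fin
open import Data.Integer as ℤ using (+[1+_]; -[1+_])
import Data.Integer.Properties as ℤ
open import Data.Nat using (ℕ; zero; suc; _+_; _*_; _∸_; _≤_; _<_; z≤n; s≤s; NonZero; >-nonZero)
open import Data.Nat.Coprimality using (Coprime)
open import Data.Nat.Divisibility using (∣1⇒≡1)
open import Data.Nat.DivMod using (_/_; _%_; m≡m%n+[m/n]*n; m%n<n; m/n*n≤m)
open import Data.Nat.Properties
open import Data.Nat.Tactic.RingSolver using (solve-∀)
open import Data.Product using (Σ; ∃; _×_; _,_; proj₁; proj₂)
open import Data.Rational as ℚ using (mkℚ; 0ℚ; 1ℚ; Positive; NonNegative)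
import Data.Rational.Properties as ℚₚ
open import Data.Rational.Solver using (module +-*-Solver)
import Data.Rational.Unnormalised as ℚᵘ
import Data.Rational.Unnormalised.Properties as ℚᵘ
open import Data.Sum using (inj₁; inj₂; [_,_]′)
open import Function using (_∘_; id)
open import Relation.Binary using (tri<; tri≈; tri>)
open import Relation.Binary.PropositionalEquality
open import Relation.Nullary using (yes; no; contradiction)

Superadditive : (ℕ → ℕ) → Set
Superadditive f = ∀ m n → f m + f n ≤ f (m + n)

module _ {f : ℕ → ℕ} (sup : Superadditive f) where

  superadditive-mono : ∀ {m n} → m ≤ n → f m ≤ f n
  superadditive-mono {m} {n} m≤n = begin
    f m               ≤⟨ m≤m+n (f m) (f (n ∸ m)) ⟩
    f m + f (n ∸ m)   ≤⟨ sup m (n ∸ m) ⟩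
    f (m + (n ∸ m))   ≡⟨ cong f (m+[n∸m]≡n m≤n) ⟩
    f n               ∎
    where open ≤-Reasoning

  superadditive-* : ∀ q m → q * f m ≤ f (q * m)
  superadditive-* zero    m = z≤n
  superadditive-* (suc q) m = ≤-trans (+-monoʳ-≤ (f m) (superadditive-* q m)) (sup m (q * m))

  superadditive-linear : ∀ m n .{{_ : NonZero m}} → f m * n ≤ f m * m + f n * m
  superadditive-linear m n = begin
    f m * n                           ≡⟨ cong (f m *_) (m≡m%n+[m/n]*n n m) ⟩
    f m * (n % m + n / m * m)         ≡⟨ regroup (f m) (n % m) (n / m) m ⟩
    f m * (n % m) + n / m * f m * m   ≤⟨ +-mono-≤ (*-monoʳ-≤ (f m) (<⇒≤ (m%n<n n m)))
                                                  (*-monoˡ-≤ m (superadditive-* (n / m) m)) ⟩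
    f m * m + f (n / m * m) * m       ≤⟨ +-monoʳ-≤ (f m * m)
                                           (*-monoˡ-≤ m (superadditive-mono (m/n*n≤m n m))) ⟩
    f m * m + f n * m                 ∎
    where
    open ≤-Reasoning
    regroup : ∀ a r q m → a * (r + q * m) ≡ a * r + q * a * m
    regroup = solve-∀

rowOnes-cong : ∀ {n} {u v : Fin n → Bool} → (∀ j → u j ≡ v j) → rowOnes u ≡ rowOnes v
rowOnes-cong {zero}          u≗v = refl
rowOnes-cong {suc n} {u} {v} u≗v with u Fin.zero | v Fin.zero | u≗v Fin.zero
... | true  | true  | refl = cong suc (rowOnes-cong (u≗v ∘ Fin.suc))
... | false | false | refl = rowOnes-cong (u≗v ∘ Fin.suc)

rowOnes-false : ∀ {n} → rowOnes {n} (λ _ → false) ≡ 0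
rowOnes-false {zero}  = refl
rowOnes-false {suc n} = rowOnes-false {n}

rowOnes-++ : ∀ b {d} (u : Fin (b + d) → Bool) →
  rowOnes u ≡ rowOnes (λ j → u (j ↑ˡ d)) + rowOnes (λ j → u (b ↑ʳ j))
rowOnes-++ zero    u = refl
rowOnes-++ (suc b) u with u Fin.zero
... | true  = cong suc (rowOnes-++ b (u ∘ Fin.suc))
... | false = rowOnes-++ b (u ∘ Fin.suc)

ones-cong : ∀ {m n} {M M′ : Matrix m n} → (∀ i j → M i j ≡ M′ i j) → ones M ≡ ones M′
ones-cong {zero}  M≗M′ = refl
ones-cong {suc m} M≗M′ = cong₂ _+_ (rowOnes-cong (M≗M′ Fin.zero)) (ones-cong (M≗M′ ∘ Fin.suc))

zeros : ∀ {m n} → Matrix m n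
zeros _ _ = false

ones-zeros : ∀ {m n} → ones (zeros {m} {n}) ≡ 0
ones-zeros {zero}      = refl
ones-zeros {suc m} {n} = cong₂ _+_ (rowOnes-false {n}) (ones-zeros {m})

ones-++-rows : ∀ a {c n} (M : Matrix (a + c) n) →
  ones M ≡ ones (λ i → M (i ↑ˡ c)) + ones (λ i → M (a ↑ʳ i))
ones-++-rows zero    M = refl
ones-++-rows (suc a) M =
  trans (cong (rowOnes (M Fin.zero) +_) (ones-++-rows a (M ∘ Fin.suc)))
        (sym (+-assoc (rowOnes (M Fin.zero)) _ _))

ones-++-cols : ∀ {m} b {d} (M : Matrix m (b + d)) →
  ones M ≡ ones (λ i j → M i (j ↑ˡ d)) + ones (λ i j → M i (b ↑ʳ j))
ones-++-cols {zero}  b M = refl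
ones-++-cols {suc m} b {d} M =
  trans (cong₂ _+_ (rowOnes-++ b (M Fin.zero)) (ones-++-cols b (M ∘ Fin.suc)))
        (interchange +-commutativeSemigroup (rowOnes (λ j → M Fin.zero (j ↑ˡ d)))
           (rowOnes (λ j → M Fin.zero (b ↑ʳ j))) _ _)

ones-subst : ∀ {m n n′} (e : n ≡ n′) (M : Matrix m n) → ones (subst (Matrix m) e M) ≡ ones M
ones-subst refl M = refl

m*s≤ones : ∀ {m n} s (A : Matrix m n) → (∀ i → s ≤ rowOnes (A i)) → m * s ≤ ones A
m*s≤ones {zero}  s A rows≥s = z≤n
m*s≤ones {suc m} s A rows≥s =
  +-mono-≤ (rows≥s Fin.zero) (m*s≤ones s (A ∘ Fin.suc) (rows≥s ∘ Fin.suc))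

data Half : Set where
  low high : Half

size : Half → ℕ → ℕ → ℕ
size low  a c = a
size high a c = c

offset : Half → ℕ → ℕ
offset low  a = 0
offset high a = a

inject : ∀ {a c} h → Fin (size h a c) → Fin (a + c)
inject {c = c} low  y = y ↑ˡ c
inject {a = a} high y = a ↑ʳ y

toℕ-inject : ∀ {a c} h (y : Fin (size h a c)) → toℕ (inject {a} {c} h y) ≡ offset h a + toℕ y
toℕ-inject {c = c} low  y = Fin.toℕ-↑ˡ y c
toℕ-inject {a = a} high y = Fin.toℕ-↑ʳ a y

toℕ-inject-low : ∀ {a c} (y : Fin a) → toℕ (inject {a} {c} low y) < a
toℕ-inject-low {c = c} y = subst (_< _) (sym (Fin.toℕ-↑ˡ y c)) (Fin.toℕ<n y)

toℕ-inject-high : ∀ {a c} (y : Fin c) → a ≤ toℕ (inject {a} {c} high y)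
toℕ-inject-high {a} y = subst (a ≤_) (sym (Fin.toℕ-↑ʳ a y)) (m≤m+n a (toℕ y))

inject-low<inject-high : ∀ {a c} (x : Fin a) (y : Fin c) →
  toℕ (inject {a} {c} low x) < toℕ (inject {a} {c} high y)
inject-low<inject-high x y = <-≤-trans (toℕ-inject-low x) (toℕ-inject-high y)

InHalf : ∀ a {c} → Half → Fin (a + c) → Set
InHalf a {c} h u = ∃ λ (y : Fin (size h a c)) → inject h y ≡ u

inHalf : ∀ a {c} (u : Fin (a + c)) → ∃ λ h → InHalf a h u
inHalf a u with splitAt a u in eq
... | inj₁ y = low  , y , Fin.splitAt⁻¹-↑ˡ eq
... | inj₂ y = high , y , Fin.splitAt⁻¹-↑ʳ eq

InHalf-low-≤ : ∀ {a c} {u v : Fin (a + c)} → toℕ u ≤ toℕ v → InHalf a low v → InHalf a low u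
InHalf-low-≤ {a} {u = u} u≤v (x , refl) with inHalf a u
... | low  , below = below
... | high , y , refl =
  contradiction (≤-<-trans (≤-trans (toℕ-inject-high y) u≤v) (toℕ-inject-low x)) (<-irrefl refl)

InHalf-high-≥ : ∀ {a c} {u v : Fin (a + c)} → toℕ v ≤ toℕ u → InHalf a high v → InHalf a high u
InHalf-high-≥ {a} {u = u} v≤u (x , refl) with inHalf a u
... | high , above = above
... | low  , y , refl =
  contradiction (≤-<-trans (≤-trans (toℕ-inject-high x) v≤u) (toℕ-inject-low y)) (<-irrefl refl)

Blocks : ℕ → ℕ → ℕ → ℕ → Set
Blocks a b c d = ∀ h h′ → Matrix (size h a c) (size h′ b d)

locate : ∀ a {c} → Fin (a + c) → Σ Half λ h → Fin (size h a c)
locate a u = [ low ,_ , high ,_ ]′ (splitAt a u)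

locate-inject : ∀ a {c} h (y : Fin (size h a c)) → locate a {c} (inject h y) ≡ (h , y)
locate-inject a {c} low  y = cong [ low ,_ , high ,_ ]′ (Fin.splitAt-↑ˡ a y c)
locate-inject a {c} high y = cong [ low ,_ , high ,_ ]′ (Fin.splitAt-↑ʳ a c y)

blocks : ∀ {a b c d} → Blocks a b c d → Matrix (a + c) (b + d)
blocks {a} {b} B u v with locate a u | locate b v
... | h , x | h′ , y = B h h′ x y

blocks-inject : ∀ {a b c d} (B : Blocks a b c d) h h′ x y →
  blocks B (inject h x) (inject h′ y) ≡ B h h′ x y
blocks-inject {a} {b} B h h′ x y rewrite locate-inject a h x | locate-inject b h′ y = refl

ones-blocks : ∀ {a b c d} (B : Blocks a b c d) →
  ones (blocks B) ≡ (ones (B low low) + ones (B low high)) + (ones (B high low) + ones (B high high))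
ones-blocks {a} {b} B =
  trans (ones-++-rows a (blocks B)) (cong₂ _+_ (ones-row-half low) (ones-row-half high))
  where
  ones-row-half : ∀ h → ones (λ i → blocks B (inject h i)) ≡ ones (B h low) + ones (B h high)
  ones-row-half h = trans (ones-++-cols b (λ i → blocks B (inject h i)))
    (cong₂ _+_ (ones-cong (blocks-inject B h low)) (ones-cong (blocks-inject B h high)))

Occurs : ∀ {m n k l} → Matrix m n → Matrix k l → (Fin k → Fin m) → (Fin l → Fin n) → Set
Occurs M P r c =
  StrictlyIncreasing r × StrictlyIncreasing c × (∀ i j → P i j ≡ true → M (r i) (c j) ≡ true)

Contains-cong : ∀ {m n k l} {M M′ : Matrix m n} {P : Matrix k l} →
  (∀ i j → M i j ≡ M′ i j) → Contains M P → Contains M′ P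
Contains-cong M≗M′ (r , c , r↑ , c↑ , hits) =
  r , c , r↑ , c↑ , λ i j Pij → trans (sym (M≗M′ _ _)) (hits i j Pij)

zeros-avoids : ∀ {m n k l} {P : Matrix k l} {i j} → P i j ≡ true → Avoids (zeros {m} {n}) P
zeros-avoids {i = i} {j} Pij (r , c , r↑ , c↑ , hits) with hits i j Pij
... | ()

subst-avoids : ∀ {m n n′ k l} {P : Matrix k l} (e : n ≡ n′) {M : Matrix m n} →
  Avoids M P → Avoids (subst (Matrix m) e M) P
subst-avoids refl = id

module _ {k m} {f : Fin k → Fin m} (f↑ : StrictlyIncreasing f) where

  strictlyIncreasing-mono-≤ : ∀ {i j} → i Fin.≤ j → f i Fin.≤ f j
  strictlyIncreasing-mono-≤ {i} {j} i≤j with Fin.<-cmp i j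
  ... | tri< i<j _ _ = <⇒≤ (f↑ i j i<j)
  ... | tri≈ _ refl _ = ≤-refl
  ... | tri> _ _ j<i = contradiction i≤j (<⇒≱ j<i)

  strictlyIncreasing-cancel-< : ∀ {i j} → f i Fin.< f j → i Fin.< j
  strictlyIncreasing-cancel-< {i} {j} fi<fj with Fin.<-cmp i j
  ... | tri< i<j _ _ = i<j
  ... | tri≈ _ refl _ = contradiction fi<fj (<-irrefl refl)
  ... | tri> _ _ j<i = contradiction fi<fj (<-asym (f↑ j i j<i))

inject-preimage : ∀ {k a c} h (r : Fin k → Fin (a + c)) → StrictlyIncreasing r →
  (∀ i → InHalf a h (r i)) →
  Σ (Fin k → Fin (size h a c)) λ r′ → StrictlyIncreasing r′ × (∀ i → inject h (r′ i) ≡ r i)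
inject-preimage {a = a} h r r↑ inside = r′ , r′↑ , proj₂ ∘ inside
  where
  r′ = proj₁ ∘ inside
  r′↑ : StrictlyIncreasing r′
  r′↑ i j i<j = +-cancelˡ-< (offset h a) _ _ (subst₂ _<_ (toℕ-inject h (r′ i)) (toℕ-inject h (r′ j))
    (subst₂ (λ u v → toℕ u < toℕ v) (sym (proj₂ (inside i))) (sym (proj₂ (inside j))) (r↑ i j i<j)))

Contains-quadrant : ∀ {a b c d k l} {M : Matrix (a + c) (b + d)} {P : Matrix k l} h h′ {r cc} →
  Occurs M P r cc → (∀ i → InHalf a h (r i)) → (∀ j → InHalf b h′ (cc j)) →
  Contains (λ x y → M (inject h x) (inject h′ y)) P
Contains-quadrant {M = M} h h′ {r} {cc} (r↑ , cc↑ , hits) rows cols =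
  let r′ , r′↑ , r′↦r = inject-preimage h r r↑ rows
      c′ , c′↑ , c′↦cc = inject-preimage h′ cc cc↑ cols
  in r′ , c′ , r′↑ , c′↑ , λ i j Pij →
       subst₂ (λ u v → M u v ≡ true) (sym (r′↦r i)) (sym (c′↦cc j)) (hits i j Pij)

Supported : ∀ {a b c d} → Blocks a b c d → (Half → Half) → Set
Supported B π = ∀ h h′ x y → B h h′ x y ≡ true → h′ ≡ π h

diagonal : ∀ {a b c d} → Matrix a b → Matrix c d → Blocks a b c d
diagonal X Y low  low  = X
diagonal X Y high high = Y
diagonal X Y _    _    = zeros

antidiagonal : ∀ {a b c d} → Matrix a d → Matrix c b → Blocks a b c d
antidiagonal X Y low  high = X
antidiagonal X Y high low  = Y
antidiagonal X Y _    _    = zeros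

opposite : Half → Half
opposite low  = high
opposite high = low

diagonal-supported : ∀ {a b c d} (X : Matrix a b) (Y : Matrix c d) → Supported (diagonal X Y) id
diagonal-supported X Y low  low  x y _  = refl
diagonal-supported X Y high high x y _  = refl
diagonal-supported X Y low  high x y ()
diagonal-supported X Y high low  x y ()

antidiagonal-supported : ∀ {a b c d} (X : Matrix a d) (Y : Matrix c b) →
  Supported (antidiagonal X Y) opposite
antidiagonal-supported X Y low  high x y _  = refl
antidiagonal-supported X Y high low  x y _  = refl
antidiagonal-supported X Y low  low  x y ()
antidiagonal-supported X Y high high x y ()

ones-diagonal : ∀ {a b c d} (X : Matrix a b) (Y : Matrix c d) →
  ones (blocks (diagonal X Y)) ≡ ones X + ones Y
ones-diagonal {a} {b} {c} {d} X Y
  rewrite ones-blocks (diagonal X Y) | ones-zeros {a} {d} | ones-zeros {c} {b} =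
  cong (_+ ones Y) (+-identityʳ (ones X))

ones-antidiagonal : ∀ {a b c d} (X : Matrix a d) (Y : Matrix c b) →
  ones (blocks (antidiagonal X Y)) ≡ ones X + ones Y
ones-antidiagonal {a} {b} {c} {d} X Y
  rewrite ones-blocks (antidiagonal X Y) | ones-zeros {a} {b} | ones-zeros {c} {d} =
  cong (ones X +_) (+-identityʳ (ones Y))

module _ {k} {P : Matrix (suc k) (suc k)} (perm : IsPermutationMatrix P) where

  private
    colOf rowOf : Fin (suc k) → Fin (suc k)
    colOf i = proj₁ (proj₁ perm i)
    rowOf j = proj₁ (proj₂ perm j)

    P-colOf : ∀ i → P i (colOf i) ≡ true
    P-colOf i = proj₁ (proj₂ (proj₁ perm i))

    P-rowOf : ∀ j → P (rowOf j) j ≡ true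
    P-rowOf j = proj₁ (proj₂ (proj₂ perm j))

    j₀ jₗ : Fin (suc k)
    j₀ = colOf Fin.zero
    jₗ = colOf (fromℕ k)

  blocks-avoids : ∀ {a b c d} (B : Blocks a b c d) (π : Half → Half) → Supported B π →
    Avoids (B low (π low)) P → Avoids (B high (π high)) P →
    (∀ cc → StrictlyIncreasing cc → InHalf b (π low) (cc j₀) → InHalf b (π high) (cc jₗ) → ⊥) →
    Avoids (blocks B) P
  blocks-avoids {a} {b} B π supported low-avoids high-avoids no-straddle
                (r , cc , occ@(r↑ , cc↑ , hits)) =
    by-halves (inHalf a (r last)) (inHalf a (r Fin.zero))
    where
    last = fromℕ k

    column-half : ∀ {i j} h → P i j ≡ true → InHalf a h (r i) → InHalf b (π h) (cc j)
    column-half {i} {j} h Pij (x , x↦ri) with inHalf b (cc j)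
    ... | h′ , y , y↦ccj = subst (λ g → InHalf b g (cc j)) (supported h h′ x y entry) (y , y↦ccj)
      where
      entry : B h h′ x y ≡ true
      entry = trans (sym (blocks-inject B h h′ x y))
        (subst₂ (λ u v → blocks B u v ≡ true) (sym x↦ri) (sym y↦ccj) (hits i j Pij))

    within : ∀ h → (∀ i → InHalf a h (r i)) → Contains (B h (π h)) P
    within h rows = Contains-cong (blocks-inject B h (π h))
      (Contains-quadrant {M = blocks B} h (π h) occ rows
        (λ j → column-half h (P-rowOf j) (rows (rowOf j))))

    by-halves : (∃ λ h → InHalf a h (r last)) → (∃ λ h → InHalf a h (r Fin.zero)) → ⊥
    by-halves (low , last-low) _ = low-avoids (within low λ i →
      InHalf-low-≤ (strictlyIncreasing-mono-≤ r↑ (Fin.≤fromℕ i)) last-low)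
    by-halves (high , _) (high , first-high) = high-avoids (within high λ i →
      InHalf-high-≥ (strictlyIncreasing-mono-≤ r↑ {Fin.zero} {i} z≤n) first-high)
    by-halves (high , last-high) (low , first-low) = no-straddle cc cc↑
      (column-half low (P-colOf Fin.zero) first-low) (column-half high (P-colOf last) last-high)

  combine : ∀ {a b c d} {X : Matrix a b} {Y : Matrix c d} → Avoids X P → Avoids Y P →
    Σ (Matrix (a + c) (b + d)) λ M → Avoids M P × ones M ≡ ones X + ones Y
  combine {a} {b} {c} {d} {X} {Y} X-avoids Y-avoids with j₀ Fin.<? jₗ
  ... | no j₀≮jₗ =
    blocks (diagonal X Y) ,
    blocks-avoids (diagonal X Y) id (diagonal-supported X Y) X-avoids Y-avoids straddle ,
    ones-diagonal X Y
    where
    straddle : ∀ cc → StrictlyIncreasing cc → InHalf b low (cc j₀) → InHalf b high (cc jₗ) → ⊥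
    straddle cc cc↑ (x , x↦) (y , y↦) = j₀≮jₗ (strictlyIncreasing-cancel-< cc↑
      (subst₂ (λ u v → toℕ u < toℕ v) x↦ y↦ (inject-low<inject-high x y)))
  ... | yes j₀<jₗ =
    subst (Matrix (a + c)) (+-comm d b) (blocks (antidiagonal X Y)) ,
    subst-avoids (+-comm d b)
      (blocks-avoids (antidiagonal X Y) opposite (antidiagonal-supported X Y)
                     X-avoids Y-avoids straddle) ,
    trans (ones-subst (+-comm d b) (blocks (antidiagonal X Y))) (ones-antidiagonal X Y)
    where
    straddle : ∀ cc → StrictlyIncreasing cc → InHalf d high (cc j₀) → InHalf d low (cc jₗ) → ⊥
    straddle cc cc↑ (x , x↦) (y , y↦) = <-asym j₀<jₗ (strictlyIncreasing-cancel-< cc↑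
      (subst₂ (λ u v → toℕ u < toℕ v) y↦ x↦ (inject-low<inject-high y x)))

  module _ {ex : ℕ → ℕ} (isEx : ∀ n → IsEx P n (ex n)) where

    ex-superadditive : Superadditive ex
    ex-superadditive a b =
      let X , X-avoids , onesX≡ex = proj₁ (isEx a)
          Y , Y-avoids , onesY≡ex = proj₁ (isEx b)
          M , M-avoids , onesM≡ = combine X-avoids Y-avoids
      in begin
        ex a + ex b      ≡⟨ cong₂ _+_ (sym onesX≡ex) (sym onesY≡ex) ⟩
        ones X + ones Y  ≡⟨ sym onesM≡ ⟩
        ones M           ≤⟨ proj₂ (isEx (a + b)) M M-avoids ⟩
        ex (a + b)       ∎
      where open ≤-Reasoning

    ones≤ex : ∀ {N t} (A : Matrix N t) → Avoids A P → ones A ≤ ex (N + t)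
    ones≤ex {N} {t} A A-avoids =
      let M , M-avoids , onesM≡ =
            combine {Y = zeros {t} {N}} A-avoids (zeros-avoids (P-colOf Fin.zero))
          M′ = subst (Matrix (N + t)) (+-comm t N) M
      in begin
        ones A                         ≡⟨ sym (+-identityʳ (ones A)) ⟩
        ones A + 0                     ≡⟨ cong (ones A +_) (sym (ones-zeros {t} {N})) ⟩
        ones A + ones (zeros {t} {N})  ≡⟨ sym onesM≡ ⟩
        ones M                         ≡⟨ sym (ones-subst (+-comm t N) M) ⟩
        ones M′                        ≤⟨ proj₂ (isEx (N + t)) M′
                                              (subst-avoids (+-comm t N) M-avoids) ⟩
        ex (N + t)                     ∎
      where open ≤-Reasoning

coprime-1 : ∀ a → Coprime a 1
coprime-1 a (_ , d∣1) = ∣1⇒≡1 d∣1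

ℕtoℚ-normalised : ∀ a → ℕtoℚ a ≡ mkℚ (ℤ.+ a) 0 (coprime-1 a)
ℕtoℚ-normalised a = ℚₚ.normalize-coprime (coprime-1 a)

ℕtoℚ-homo-+ : ∀ a b → ℕtoℚ (a + b) ≡ ℕtoℚ a ℚ.+ ℕtoℚ b
ℕtoℚ-homo-+ a b = sym (trans (cong₂ ℚ._+_ (ℕtoℚ-normalised a) (ℕtoℚ-normalised b))
  (ℚₚ./-cong (cong₂ ℤ._+_ (ℤ.*-identityʳ (ℤ.+ a)) (ℤ.*-identityʳ (ℤ.+ b))) refl))

ℕtoℚ-homo-* : ∀ a b → ℕtoℚ (a * b) ≡ ℕtoℚ a ℚ.* ℕtoℚ b
ℕtoℚ-homo-* a b = sym (trans (cong₂ ℚ._*_ (ℕtoℚ-normalised a) (ℕtoℚ-normalised b))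
  (ℚₚ./-cong (sym (ℤ.pos-* a b)) refl))

ℕtoℚ-mono-≤ : ∀ {a b} → a ≤ b → ℕtoℚ a ℚ.≤ ℕtoℚ b
ℕtoℚ-mono-≤ {a} {b} a≤b = subst₂ ℚ._≤_ (sym (ℕtoℚ-normalised a)) (sym (ℕtoℚ-normalised b))
  (ℚ.*≤* (subst₂ ℤ._≤_ (sym (ℤ.*-identityʳ (ℤ.+ a))) (sym (ℤ.*-identityʳ (ℤ.+ b)))
                       (ℤ.+≤+ a≤b)))

ℕtoℚ-suc-positive : ∀ n → Positive (ℕtoℚ (suc n))
ℕtoℚ-suc-positive n = subst Positive (sym (ℕtoℚ-normalised (suc n))) _

/suc-*-suc : ∀ a n → (ℤ.+ a ℚ./ suc n) ℚ.* ℕtoℚ (suc n) ≡ ℕtoℚ a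
/suc-*-suc a n = ℚₚ.toℚᵘ-injective (begin
  ℚ.toℚᵘ (a/d ℚ.* ℕtoℚ (suc n))                   ≈⟨ ℚₚ.toℚᵘ-homo-* a/d (ℕtoℚ (suc n)) ⟩
  ℚ.toℚᵘ a/d ℚᵘ.* ℚ.toℚᵘ (ℕtoℚ (suc n))          ≈⟨ ℚᵘ.*-cong
                                                       (ℚₚ.toℚᵘ-fromℚᵘ (ℚᵘ.mkℚᵘ (ℤ.+ a) n))
                                                       (ℚₚ.toℚᵘ-fromℚᵘ (ℚᵘ.mkℚᵘ (ℤ.+ suc n) 0)) ⟩
  ℚᵘ.mkℚᵘ (ℤ.+ a) n ℚᵘ.* ℚᵘ.mkℚᵘ (ℤ.+ suc n) 0   ≈⟨ ℚᵘ.*≡* (ℤ.*-assoc (ℤ.+ a) (ℤ.+ suc n) (ℤ.+ 1)) ⟩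
  ℚᵘ.mkℚᵘ (ℤ.+ a) 0                              ≈⟨ ℚᵘ.≃-sym (ℚₚ.toℚᵘ-fromℚᵘ (ℚᵘ.mkℚᵘ (ℤ.+ a) 0)) ⟩
  ℚ.toℚᵘ (ℕtoℚ a)                                ∎)
  where
  open ℚᵘ.≃-Reasoning
  a/d = ℤ.+ a ℚ./ suc n

archimedean : ∀ ε → 0ℚ ℚ.< ε → ∃ λ q → ∀ C → ℕtoℚ C ℚ.≤ ε ℚ.* ℕtoℚ (suc q * C)
archimedean ε@(mkℚ +[1+ a ] q _) _ = q , λ C → begin
  ℕtoℚ C                             ≤⟨ ℕtoℚ-mono-≤ (m≤n*m C (suc a)) ⟩
  ℕtoℚ (suc a * C)                   ≡⟨ ℕtoℚ-homo-* (suc a) C ⟩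
  ℕtoℚ (suc a) ℚ.* ℕtoℚ C            ≡⟨ cong (ℚ._* ℕtoℚ C) (sym (/suc-*-suc (suc a) q)) ⟩
  (ε′ ℚ.* ℕtoℚ (suc q)) ℚ.* ℕtoℚ C   ≡⟨ ℚₚ.*-assoc ε′ (ℕtoℚ (suc q)) (ℕtoℚ C) ⟩
  ε′ ℚ.* (ℕtoℚ (suc q) ℚ.* ℕtoℚ C)   ≡⟨ cong₂ ℚ._*_ (ℚₚ.↥p/↧p≡p ε) (sym (ℕtoℚ-homo-* (suc q) C)) ⟩
  ε ℚ.* ℕtoℚ (suc q * C)             ∎
  where
  open ℚₚ.≤-Reasoning
  ε′ = ℤ.+ suc a ℚ./ suc q
archimedean (mkℚ (ℤ.+ 0)   _ _) (ℚ.*<* (ℤ.+<+ ()))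
archimedean (mkℚ -[1+ _ ] _ _) (ℚ.*<* ())

Eventually : (ℕ → Set) → Set
Eventually p = ∃ λ n₀ → ∀ n → n₀ ≤ n → p n

ratioSeq-lower-bound : ∀ (f : ℕ → ℕ) W m C → (∀ n → W * suc n ≤ C + f (suc n) * m) →
  ∀ ε → 0ℚ ℚ.< ε → Eventually λ n → ℕtoℚ W ℚ.≤ ratioSeq f n ℚ.* ℕtoℚ m ℚ.+ ε
ratioSeq-lower-bound f W m C bound ε ε>0 with archimedean ε ε>0
... | q , C≤ε* = suc q * C , λ n n₀≤n →
  let instance
        ε≥0 : NonNegative ε
        ε≥0 = ℚ.nonNegative (ℚₚ.<⇒≤ ε>0)
        d>0 : Positive (ℕtoℚ (suc n))
        d>0 = ℕtoℚ-suc-positive n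
      d = ℕtoℚ (suc n)
      x = ratioSeq f n
      E = ℕtoℚ (f (suc n))
      C≤εd : ℕtoℚ C ℚ.≤ ε ℚ.* d
      C≤εd = ℚₚ.≤-trans (C≤ε* C)
        (ℚₚ.*-monoˡ-≤-nonNeg ε (ℕtoℚ-mono-≤ (≤-trans n₀≤n (n≤1+n n))))
  in ℚₚ.*-cancelʳ-≤-pos d (begin
    ℕtoℚ W ℚ.* d                        ≡⟨ sym (ℕtoℚ-homo-* W (suc n)) ⟩
    ℕtoℚ (W * suc n)                    ≤⟨ ℕtoℚ-mono-≤ (bound n) ⟩
    ℕtoℚ (C + f (suc n) * m)            ≡⟨ trans (ℕtoℚ-homo-+ C (f (suc n) * m))
                                               (cong (ℕtoℚ C ℚ.+_) (ℕtoℚ-homo-* (f (suc n)) m)) ⟩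
    ℕtoℚ C ℚ.+ E ℚ.* ℕtoℚ m             ≤⟨ ℚₚ.+-monoˡ-≤ (E ℚ.* ℕtoℚ m) C≤εd ⟩
    ε ℚ.* d ℚ.+ E ℚ.* ℕtoℚ m            ≡⟨ cong (λ z → ε ℚ.* d ℚ.+ z ℚ.* ℕtoℚ m)
                                               (sym (/suc-*-suc (f (suc n)) n)) ⟩
    ε ℚ.* d ℚ.+ (x ℚ.* d) ℚ.* ℕtoℚ m    ≡⟨ solve 4 (λ ε d x m → ε :* d :+ (x :* d) :* m
                                                               := (x :* m :+ ε) :* d)
                                               refl ε d x (ℕtoℚ m) ⟩
    (x ℚ.* ℕtoℚ m ℚ.+ ε) ℚ.* d          ∎)
  where
  open ℚₚ.≤-Reasoning
  open +-*-Solver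

BoundHolds-intro : ∀ r N s t →
  (∀ ε → 0ℚ ℚ.< ε → Eventually λ n → ℕtoℚ (N * s) ℚ.≤ r n ℚ.* ℕtoℚ (N + t) ℚ.+ ε) →
  BoundHolds r N s t
BoundHolds-intro r N s t eventually ε ε>0 with eventually ε ε>0
... | n₀ , Ns≤ = n₀ , λ n n₀≤n →
  let x = r n ; N′ = ℕtoℚ N ; s′ = ℕtoℚ s ; t′ = ℕtoℚ t
      Ns≤′ : N′ ℚ.* s′ ℚ.≤ x ℚ.* (N′ ℚ.+ t′) ℚ.+ ε
      Ns≤′ = subst₂ (λ u v → u ℚ.≤ x ℚ.* v ℚ.+ ε) (ℕtoℚ-homo-* N s) (ℕtoℚ-homo-+ N t)
                    (Ns≤ n n₀≤n)
  in begin
    N′ ℚ.* (s′ ℚ.- x)                              ≡⟨ solve 3 (λ N s x → N :* (s :- x)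
                                                                   := N :* s :+ (:- (N :* x)))
                                                          refl N′ s′ x ⟩
    N′ ℚ.* s′ ℚ.+ ℚ.- (N′ ℚ.* x)                   ≤⟨ ℚₚ.+-monoˡ-≤ (ℚ.- (N′ ℚ.* x)) Ns≤′ ⟩
    (x ℚ.* (N′ ℚ.+ t′) ℚ.+ ε) ℚ.+ ℚ.- (N′ ℚ.* x)   ≡⟨ solve 4 (λ N t x ε →
                                                            (x :* (N :+ t) :+ ε) :+ (:- (N :* x))
                                                            := x :* t :+ ε)
                                                          refl N′ t′ x ε ⟩
    x ℚ.* t′ ℚ.+ ε                                 ∎
  where
  open ℚₚ.≤-Reasoning
  open +-*-Solver

lemma2p1 : (k : ℕ) (P : Matrix k k) → IsPermutationMatrix P →
    (ex : ℕ → ℕ) → (∀ n → IsEx P n (ex n)) →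
    LimitExists (ratioSeq ex) →
    2 ≤ k → LimGreater (ratioSeq ex) 1ℚ →
    (s t : ℕ) → 0 < s → s ≤ t →
    LimLess (ratioSeq ex) (ℕtoℚ s) →
    (N : ℕ) (A : Matrix N t) → Avoids A P → (∀ i → s ≤ rowOnes (A i)) →
    BoundHolds (ratioSeq ex) N s t
lemma2p1 _ P perm ex isEx _ (s≤s _) _ s t 0<s s≤t _ N A A-avoids rows≥s =
  BoundHolds-intro (ratioSeq ex) N s t (ratioSeq-lower-bound ex (N * s) m (ex m * m) λ n → begin
    N * s * suc n               ≤⟨ *-monoˡ-≤ (suc n) Ns≤ex ⟩
    ex m * suc n                ≤⟨ superadditive-linear {ex} (ex-superadditive perm isEx) m (suc n) ⟩
    ex m * m + ex (suc n) * m   ∎)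
  where
  open ≤-Reasoning
  m = N + t
  instance
    m≢0 : NonZero m
    m≢0 = >-nonZero (<-≤-trans 0<s (≤-trans s≤t (m≤n+m t N)))
  Ns≤ex : N * s ≤ ex m
  Ns≤ex = ≤-trans (m*s≤ones s A rows≥s) (ones≤ex perm isEx A A-avoids)
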